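{- Let $n\ge1$, $N=2^n$ and $G_{\mathsf{NEQ}}=\{(u,v)\in[N]\times[N]:u\ne v\}$. Then $\rho_{\mathsf{can}}(G_{\mathsf{NEQ}},\mathcal G_{N,N})\le\rho_{\mathsf{ultra}}(G_{\mathsf{NEQ}},\mathcal G_{N,N})$.
   Context: $\mathcal G_{N,N}=\{R_1,\dots,R_N,C_1,\dots,C_N\}$ on $\Gamma=[N]\times[N]$, $R_i=\{(i,j):j\in[N]\}$, $C_j=\{(i,j):i\in[N]\}$. For $A\subseteq\Gamma$, $U=\Gamma\setminus A$. A semi-filter over $U$ is a nonempty family $\mathcal F\subseteq\mathcal P(U)$ with $\emptyset\notin\mathcal F$ that is upward closed within $\mathcal P(U)$; it is a semi-ultra-filter if moreover for every $W\subseteq U$, $W\in\mathcal F$ or $U\setminus W\in\mathcal F$. $\mathcal F$ is above $w\in\Gamma$ if $B\cap U\in\mathcal F$ for every generator $B$ with $w\in B$. A pair $(E,H)$ of subsets of $U$ covers $\mathcal F$ if $E,H\in\mathcal F$ but $E\cap H\notin\mathcal F$. $\rho_{\mathsf{ultra}}(A,\mathcal B)$ is the minimum number of pairs of subsets of $U$ such that every semi-ultra-filter over $U$ above some $a\in A$ is covered by one of them. Canonical cover complexity: for $G\subseteq\Gamma$, $\overline G=\Gamma\setminus G$, and $e=(u,v)\in G$, let $\mathcal F_e=\{W\subseteq\overline G:R_u\cap\overline G\subseteq W\text{ or }C_v\cap\overline G\subseteq W\}$; $\mathfrak F^G_{\mathsf{can}}$ is the set of those $\mathcal F_e$ ($e\in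 G$) that are semi-filters over $\overline G$; $\rho_{\mathsf{can}}(G,\mathcal G_{N,N})$ is the minimum number of pairs of subsets of $\overline G$ such that every member of $\mathfrak F^G_{\mathsf{can}}$ is covered by one of them. -}

module Defs where

open import Data.Nat using (ℕ; _≤_; _^_)
open import Data.Fin using (Fin; _≟_)
open import Data.Bool using (Bool; true; false; not)
open import Data.Vec using (Vec; lookup; tabulate)
open import Data.Product using (_×_; _,_; Σ; ∃; ∃-syntax)
open import Data.Sum using (_⊎_)
open import Relation.Nullary using (¬_)
open import Relation.Nullary.Decidable using (⌊_⌋)
open import Relation.Binary.PropositionalEquality using (_≡_)
open import Level using (0ℓ; suc)

Γ : ℕ → Set
Γ N = Fin N × Fin N

Sub : ℕ → Set
Sub N = Vec (Vec Bool N) N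

_∈ₛ_ : ∀ {N} → Γ N → Sub N → Set
(i , j) ∈ₛ W = lookup (lookup W i) j ≡ true

_⊆ₛ_ : ∀ {N} → Sub N → Sub N → Set
W ⊆ₛ V = ∀ p → p ∈ₛ W → p ∈ₛ V

∅ₛ : ∀ {N} → Sub N
∅ₛ = tabulate λ _ → tabulate λ _ → false

_∩ₛ_ : ∀ {N} → Sub N → Sub N → Sub N
W ∩ₛ V = tabulate λ i → tabulate λ j →
  Data.Bool._∧_ (lookup (lookup W i) j) (lookup (lookup V i) j)

∁ₛ : ∀ {N} → Sub N → Sub N
∁ₛ W = tabulate λ i → tabulate λ j → not (lookup (lookup W i) j)

_∖ₛ_ : ∀ {N} → Sub N → Sub N → Sub N
U ∖ₛ W = U ∩ₛ ∁ₛ W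

-- Generators of 𝒢_{N,N}: rows R_i and columns C_j
data Gen (N : ℕ) : Set where
  row : Fin N → Gen N
  col : Fin N → Gen N

Row : ∀ {N} → Fin N → Sub N
Row i = tabulate λ i' → tabulate λ _ → ⌊ i' ≟ i ⌋

Col : ∀ {N} → Fin N → Sub N
Col j = tabulate λ _ → tabulate λ j' → ⌊ j' ≟ j ⌋

gen : ∀ {N} → Gen N → Sub N
gen (row i) = Row i
gen (col j) = Col j

-- A family of subsets (of Γ); a family over P(U) is required to contain only subsets of U
Family : ℕ → Set₁
Family N = Sub N → Set

record SemiFilter {N} (U : Sub N) (F : Family N) : Set where
  field
    inPU      : ∀ W → F W → W ⊆ₛ U
    nonempty  : ∃[ W ] F W
    noEmpty   : ¬ F ∅ₛ
    upClosed  : ∀ W V → F W → W ⊆ₛ V → V ⊆ₛ U → F V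

record SemiUltraFilter {N} (U : Sub N) (F : Family N) : Set where
  field
    semiFilter : SemiFilter U F
    ultra      : ∀ W → W ⊆ₛ U → F W ⊎ F (U ∖ₛ W)

Above : ∀ {N} → Sub N → Family N → Γ N → Set
Above U F w = ∀ (B : Gen _) → w ∈ₛ gen B → F (gen B ∩ₛ U)

Covers : ∀ {N} → Sub N × Sub N → Family N → Set
Covers (E , H) F = F E × F H × ¬ F (E ∩ₛ H)

PairsIn : ∀ {N} → Sub N → ℕ → Set
PairsIn {N} U k = Σ (Fin k → Sub N × Sub N)
  λ P → ∀ i → (Data.Product.proj₁ (P i) ⊆ₛ U) × (Data.Product.proj₂ (P i) ⊆ₛ U)

-- ρ_ultra(A, 𝒢_{N,N}) ≤ k  :  there are k pairs of subsets of U = Γ∖A covering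
-- every semi-ultra-filter over U above some a ∈ A
UltraCover : ∀ {N} → Sub N → ℕ → Set₁
UltraCover {N} A k = Σ (PairsIn (∁ₛ A) k) λ P →
  ∀ (F : Family N) → SemiUltraFilter (∁ₛ A) F →
    (∃[ a ] (a ∈ₛ A × Above (∁ₛ A) F a)) →
    ∃[ i ] Covers (Data.Product.proj₁ P i) F

Fcan : ∀ {N} → Sub N → Γ N → Family N
Fcan G (u , v) W = W ⊆ₛ ∁ₛ G × ((Row u ∩ₛ ∁ₛ G) ⊆ₛ W ⊎ (Col v ∩ₛ ∁ₛ G) ⊆ₛ W)

-- ρ_can(G, 𝒢_{N,N}) ≤ k
CanCover : ∀ {N} → Sub N → ℕ → Set
CanCover {N} G k = Σ (PairsIn (∁ₛ G) k) λ P →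
  ∀ (e : Γ N) → e ∈ₛ G → SemiFilter (∁ₛ G) (Fcan G e) →
    ∃[ i ] Covers (Data.Product.proj₁ P i) (Fcan G e)

GNEQ : (N : ℕ) → Sub N
GNEQ N = tabulate λ u → tabulate λ v → not ⌊ u ≟ v ⌋

{-# OPTIONS --safe #-}
module Submission where

open import Defs
open import Data.Nat using (ℕ; _≤_; _^_)
open import Data.Fin using (Fin; _≟_)
open import Data.Bool using (Bool; true; false; not; _∧_)
open import Data.Bool.Properties using (∧-conicalˡ; ∧-conicalʳ) renaming (_≟_ to _≟ᵇ_)
open import Data.Vec using (lookup; tabulate)
open import Data.Vec.Properties using (lookup∘tabulate)
open import Data.Product using (_,_)
open import Data.Sum using (_⊎_; inj₁; inj₂)
open import Relation.Nullary using (Dec; yes; no; ¬_; contradiction)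
open import Relation.Nullary.Decidable using (⌊_⌋; isYes≗does; dec-true; dec-false; decidable-stable)
open import Relation.Binary.PropositionalEquality using (_≡_; refl; sym; trans; cong; cong₂; subst)

-- The complement of G_NEQ is the diagonal, which every row meets in a single point.  So for
-- e = (u , v) the canonical family 𝓕_e contains every subset of the diagonal through (u , u);
-- as either W or its complement in the diagonal contains (u , u), 𝓕_e is ultra.  Since 𝓕_e is
-- above e by construction, a cover of the semi-ultra-filters above points of G_NEQ covers
-- every canonical semi-filter.

Ultra : ∀ {N} → Sub N → Family N → Set
Ultra U F = ∀ W → W ⊆ₛ U → F W ⊎ F (U ∖ₛ W)

private
  not-true⇒≢true : ∀ {x} → not x ≡ true → ¬ x ≡ true
  not-true⇒≢true {false} _ ()

  ≢true⇒not-true : ∀ {x} → ¬ x ≡ true → not x ≡ true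
  ≢true⇒not-true {false} _   = refl
  ≢true⇒not-true {true}  x≢t = contradiction refl x≢t

  ⌊⌋-true⁻ : ∀ {A : Set} (a? : Dec A) → ⌊ a? ⌋ ≡ true → A
  ⌊⌋-true⁻ (yes a) _ = a

  ⌊⌋-true⁺ : ∀ {A : Set} (a? : Dec A) → A → ⌊ a? ⌋ ≡ true
  ⌊⌋-true⁺ a? a = trans (isYes≗does a?) (dec-true a? a)

  ⌊⌋-false⁺ : ∀ {A : Set} (a? : Dec A) → ¬ A → ⌊ a? ⌋ ≡ false
  ⌊⌋-false⁺ a? ¬a = trans (isYes≗does a?) (dec-false a? ¬a)

module _ {N : ℕ} where

  lookup²∘tabulate² : (f : Fin N → Fin N → Bool) (i j : Fin N) →
    lookup (lookup (tabulate λ i → tabulate λ j → f i j) i) j ≡ f i j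
  lookup²∘tabulate² f i j =
    trans (cong (λ r → lookup r j) (lookup∘tabulate (λ i → tabulate (f i)) i))
          (lookup∘tabulate (f i) j)

  ∈-tabulate⁻ : ∀ (f : Fin N → Fin N → Bool) i j →
    (i , j) ∈ₛ (tabulate λ i → tabulate λ j → f i j) → f i j ≡ true
  ∈-tabulate⁻ f i j = trans (sym (lookup²∘tabulate² f i j))

  ∈-tabulate⁺ : ∀ (f : Fin N → Fin N → Bool) i j →
    f i j ≡ true → (i , j) ∈ₛ (tabulate λ i → tabulate λ j → f i j)
  ∈-tabulate⁺ f i j = trans (lookup²∘tabulate² f i j)

  _∈ₛ?_ : ∀ (p : Γ N) W → Dec (p ∈ₛ W)
  (i , j) ∈ₛ? W = lookup (lookup W i) j ≟ᵇ true

  ∈-∩ₛ⁻ˡ : ∀ (W V : Sub N) p → p ∈ₛ (W ∩ₛ V) → p ∈ₛ W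
  ∈-∩ₛ⁻ˡ W V (i , j) p∈ = ∧-conicalˡ _ _ (∈-tabulate⁻ _ i j p∈)

  ∈-∩ₛ⁻ʳ : ∀ (W V : Sub N) p → p ∈ₛ (W ∩ₛ V) → p ∈ₛ V
  ∈-∩ₛ⁻ʳ W V (i , j) p∈ = ∧-conicalʳ _ _ (∈-tabulate⁻ _ i j p∈)

  ∈-∩ₛ⁺ : ∀ (W V : Sub N) p → p ∈ₛ W → p ∈ₛ V → p ∈ₛ (W ∩ₛ V)
  ∈-∩ₛ⁺ W V (i , j) p∈W p∈V = ∈-tabulate⁺ _ i j (cong₂ _∧_ p∈W p∈V)

  ∈-∁ₛ⁻ : ∀ (W : Sub N) p → p ∈ₛ ∁ₛ W → ¬ p ∈ₛ W
  ∈-∁ₛ⁻ W (i , j) p∈ = not-true⇒≢true (∈-tabulate⁻ _ i j p∈)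

  ∈-∁ₛ⁺ : ∀ (W : Sub N) p → ¬ p ∈ₛ W → p ∈ₛ ∁ₛ W
  ∈-∁ₛ⁺ W (i , j) p∉ = ∈-tabulate⁺ _ i j (≢true⇒not-true p∉)

  ∈-Row⁻ : ∀ (u i j : Fin N) → (i , j) ∈ₛ Row u → i ≡ u
  ∈-Row⁻ u i j p∈ = ⌊⌋-true⁻ (i ≟ u) (∈-tabulate⁻ _ i j p∈)

  ∈-Col⁻ : ∀ (v i j : Fin N) → (i , j) ∈ₛ Col v → j ≡ v
  ∈-Col⁻ v i j p∈ = ⌊⌋-true⁻ (j ≟ v) (∈-tabulate⁻ _ i j p∈)

  ∈-∁GNEQ⁻ : ∀ (i j : Fin N) → (i , j) ∈ₛ ∁ₛ (GNEQ N) → i ≡ j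
  ∈-∁GNEQ⁻ i j p∈ = decidable-stable (i ≟ j) λ i≢j → ∈-∁ₛ⁻ (GNEQ N) (i , j) p∈
    (∈-tabulate⁺ (λ u v → not ⌊ u ≟ v ⌋) i j (cong not (⌊⌋-false⁺ (i ≟ j) i≢j)))

  ∈-∁GNEQ-diag : ∀ (i : Fin N) → (i , i) ∈ₛ ∁ₛ (GNEQ N)
  ∈-∁GNEQ-diag i = ∈-∁ₛ⁺ (GNEQ N) (i , i) λ p∈ →
    not-true⇒≢true (∈-tabulate⁻ (λ u v → not ⌊ u ≟ v ⌋) i i p∈) (⌊⌋-true⁺ (i ≟ i) refl)

  Row∩∁GNEQ-subsingleton : ∀ (u : Fin N) q → q ∈ₛ (Row u ∩ₛ ∁ₛ (GNEQ N)) → q ≡ (u , u)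
  Row∩∁GNEQ-subsingleton u (i , j) q∈
    with ∈-Row⁻ u i j (∈-∩ₛ⁻ˡ (Row u) (∁ₛ (GNEQ N)) (i , j) q∈)
       | ∈-∁GNEQ⁻ i j (∈-∩ₛ⁻ʳ (Row u) (∁ₛ (GNEQ N)) (i , j) q∈)
  ... | refl | refl = refl

  ⊆ₛ-by-singleton : ∀ (X : Sub N) {p} → (∀ q → q ∈ₛ X → q ≡ p) → ∀ W → p ∈ₛ W → X ⊆ₛ W
  ⊆ₛ-by-singleton _ X⊆p W p∈W q q∈X = subst (_∈ₛ W) (sym (X⊆p q q∈X)) p∈W

  Fcan-ultra : ∀ (G : Sub N) (u v : Fin N) p → p ∈ₛ ∁ₛ G →
    (∀ q → q ∈ₛ (Row u ∩ₛ ∁ₛ G) → q ≡ p) → Ultra (∁ₛ G) (Fcan G (u , v))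
  Fcan-ultra G u v p p∈U row⊆p W W⊆U with p ∈ₛ? W
  ... | yes p∈W = inj₁ (W⊆U , inj₁ (⊆ₛ-by-singleton (Row u ∩ₛ ∁ₛ G) row⊆p W p∈W))
  ... | no  p∉W = inj₂ (∈-∩ₛ⁻ˡ (∁ₛ G) (∁ₛ W) ,
    inj₁ (⊆ₛ-by-singleton (Row u ∩ₛ ∁ₛ G) row⊆p (∁ₛ G ∖ₛ W)
           (∈-∩ₛ⁺ (∁ₛ G) (∁ₛ W) p p∈U (∈-∁ₛ⁺ W p p∉W))))

  Fcan-above : ∀ (G : Sub N) e → Above (∁ₛ G) (Fcan G e) e
  Fcan-above G (u , v) (row i) e∈ with ∈-Row⁻ i u v e∈
  ... | refl = ∈-∩ₛ⁻ʳ (Row u) (∁ₛ G) , inj₁ (λ _ q∈ → q∈)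
  Fcan-above G (u , v) (col j) e∈ with ∈-Col⁻ j u v e∈
  ... | refl = ∈-∩ₛ⁻ʳ (Col v) (∁ₛ G) , inj₂ (λ _ q∈ → q∈)

  canCover-from-ultraCover : ∀ (G : Sub N) {k} →
    (∀ e → e ∈ₛ G → Ultra (∁ₛ G) (Fcan G e)) → UltraCover G k → CanCover G k
  canCover-from-ultraCover G ultra (P , covers) = P , λ e e∈G semiFilter →
    covers (Fcan G e) (record { semiFilter = semiFilter ; ultra = ultra e e∈G })
           (e , e∈G , Fcan-above G e)

proposition4p11 : ∀ (n : ℕ) → 1 ≤ n → ∀ (k : ℕ) →
    UltraCover (GNEQ (2 ^ n)) k → CanCover (GNEQ (2 ^ n)) k
proposition4p11 n _ _ = canCover-from-ultraCover (GNEQ (2 ^ n)) λ (u , v) _ →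
  Fcan-ultra (GNEQ (2 ^ n)) u v (u , u) (∈-∁GNEQ-diag u) (Row∩∁GNEQ-subsingleton u)
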